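{- Let $a,b,c$ be positive integers such that $(ab+1)(ac+1)(bc+1)$ is a perfect square. Then each of $ab+1$, $ac+1$, $bc+1$ is a perfect square. -}

module Defs where

open import Data.Nat using (ℕ; _*_)
open import Data.Product using (∃)
open import Relation.Binary.PropositionalEquality using (_≡_)

IsSquare : ℕ → Set
IsSquare n = ∃ λ k → n ≡ k * k

-- Call (a, b, c, d) regular when (a + b − c − d)² = 4(ab + 1)(cd + 1), a condition symmetric in the four
-- entries. If (ab + 1)(ac + 1)(bc + 1) = k², then (a, b, c, a + b + c + 2abc + 2k) is regular, so it suffices
-- that in a regular quadruple of naturals every product of two entries plus one is a square. This goes by
-- induction on a + b + c + d, with d the largest entry. If an entry is 0, say d, the condition reads
-- (a + b − c)² = 4(ab + 1), so ab + 1 is a square. Otherwise, read as a quadratic in d, the condition has the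
-- second root d′ = 2(a + b + c + 2abc) − d, which is nonnegative and, as d d′ < d², smaller than d. By induction
-- ab + 1 = r², ac + 1 = s², bc + 1 = t², and the discriminant forces d = a + b + c + 2abc ± 2rst, whence
-- ad + 1 = (at ± rs)², and likewise for bd + 1 and cd + 1.

module Submission where

open import Defs
open import Data.Product using (_×_; _,_; ∃)
open import Data.Sum using (_⊎_; inj₁; inj₂; [_,_]′)
open import Function using (id)
open import Data.List using (_∷_; [])
open import Relation.Binary.PropositionalEquality using (_≡_; refl; sym; trans; cong; cong₂; subst; module ≡-Reasoning)
open import Relation.Nullary using (contradiction)
import Data.Nat as ℕ
open ℕ using (ℕ; zero; suc; z≤n)
open import Data.Nat.Divisibility using (divides)
open import Data.Nat.Primality using (euclidsLemma; prime[2])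
import Data.Nat.Properties as ℕ
import Data.Nat.Tactic.RingSolver as ℕ-Solver
open import Algebra.Bundles.Raw using (RawRing)
open import Level using (0ℓ)

square≡4*⇒isSquare : ∀ {m} n → n ℕ.* n ≡ 4 ℕ.* m → IsSquare m
square≡4*⇒isSquare {m} n n²≡4m
  with [ id , id ]′ (euclidsLemma n n prime[2] (divides (2 ℕ.* m) (trans n²≡4m (ℕ-Solver.solve (m ∷ [])))))
... | divides q n≡2q = q , ℕ.*-cancelˡ-≡ m (q ℕ.* q) 4 (begin
  4 ℕ.* m                 ≡⟨ sym n²≡4m ⟩
  n ℕ.* n                 ≡⟨ cong₂ ℕ._*_ n≡2q n≡2q ⟩
  q ℕ.* 2 ℕ.* (q ℕ.* 2)   ≡⟨ ℕ-Solver.solve (q ∷ []) ⟩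
  4 ℕ.* (q ℕ.* q)         ∎)
  where open ≡-Reasoning

-- The quantities are defined over an arbitrary ring signature, so that the ring solver can be run on the
-- same definitions: they are instantiated at ℤ and at the solver's syntax of polynomial expressions.
module RegularityForm {c ℓ} (R : RawRing c ℓ) (κ : ℕ → RawRing.Carrier R) where
  open RawRing R

  infixl 6 _-_
  _-_ : Carrier → Carrier → Carrier
  x - y = x + - y

  -- (a + b − c − d)² − 4(ab + 1)(cd + 1), expanded.
  regularity : Carrier → Carrier → Carrier → Carrier → Carrier
  regularity a b c d =
    a * a + b * b + c * c + d * d - κ 2 * (a * b + a * c + a * d + b * c + b * d + c * d) - κ 4 * a * b * c * d - κ 4

  -- As a quadratic in d, regularity a b c d has roots summing to 2 · midpoint a b c; jump gives the other root.
  midpoint : Carrier → Carrier → Carrier → Carrier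
  midpoint a b c = a + b + c + κ 2 * a * b * c

  jump : Carrier → Carrier → Carrier → Carrier → Carrier
  jump a b c d = κ 2 * midpoint a b c - d

  pairProduct : Carrier → Carrier → Carrier → Carrier
  pairProduct a b c = (a * b + 1#) * (a * c + 1#) * (b * c + 1#)

module Regularity where
  open import Data.Integer.Base
    using (ℤ; +_; -[1+_]; 0ℤ; 1ℤ; ∣_∣; _+_; _-_; _*_; -_; _≤_; _<_; +≤+; +<+; +-*-rawRing)
  open import Data.Integer.Properties
    using ( pos-+; pos-*; abs-*; neg-involutive; +-identityʳ; +-inverseʳ; i-j≡0⇒i≡j
          ; i*j≡0⇒i≡0∨j≡0; +-mono-≤; +-mono-≤-<; +-monoʳ-<; i≤j⇒0≤j-i; 0≤i⇒+∣i∣≡i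
          ; <⇒≢; drop‿+<+; *-cancelʳ-<-nonNeg; module ≤-Reasoning )
  open import Data.Integer.Tactic.RingSolver using (ring; solve-∀)
  open import Tactic.RingSolver.NonReflective ring using (Expr; Κ; _⊕_; _⊗_; ⊝_; _⊜_; solve)

  open RegularityForm +-*-rawRing +_ using (regularity; midpoint; jump; pairProduct)

  exprRing : ℕ → RawRing 0ℓ 0ℓ
  exprRing n = record
    { Carrier = Expr ℤ n ; _≈_ = _≡_ ; _+_ = _⊕_ ; _*_ = _⊗_ ; -_ = ⊝_ ; 0# = Κ 0ℤ ; 1# = Κ 1ℤ }

  module E {n} = RegularityForm (exprRing n) (λ k → Κ (+ k))

  record Regular (a b c d : ℕ) : Set where
    constructor regular
    field
      isRoot : regularity (+ a) (+ b) (+ c) (+ d) ≡ 0ℤ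

  regularity-swap₁₂ : ∀ a b c d → regularity a b c d ≡ regularity b a c d
  regularity-swap₁₂ = solve 4 (λ a b c d → E.regularity a b c d ⊜ E.regularity b a c d) refl

  regularity-swap₁₃ : ∀ a b c d → regularity a b c d ≡ regularity c b a d
  regularity-swap₁₃ = solve 4 (λ a b c d → E.regularity a b c d ⊜ E.regularity c b a d) refl

  regularity-swap₂₃ : ∀ a b c d → regularity a b c d ≡ regularity a c b d
  regularity-swap₂₃ = solve 4 (λ a b c d → E.regularity a b c d ⊜ E.regularity a c b d) refl

  regularity-swap₁₄ : ∀ a b c d → regularity a b c d ≡ regularity d b c a
  regularity-swap₁₄ = solve 4 (λ a b c d → E.regularity a b c d ⊜ E.regularity d b c a) refl

  regularity-swap₂₄ : ∀ a b c d → regularity a b c d ≡ regularity a d c b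
  regularity-swap₂₄ = solve 4 (λ a b c d → E.regularity a b c d ⊜ E.regularity a d c b) refl

  regularity-swap₃₄ : ∀ a b c d → regularity a b c d ≡ regularity a b d c
  regularity-swap₃₄ = solve 4 (λ a b c d → E.regularity a b c d ⊜ E.regularity a b d c) refl

  regularity-jump : ∀ a b c d → regularity a b c (jump a b c d) ≡ regularity a b c d
  regularity-jump = solve 4 (λ a b c d → E.regularity a b c (E.jump a b c d) ⊜ E.regularity a b c d) refl

  regularity-vieta : ∀ a b c d → jump a b c d * d ≡ regularity a b c 0ℤ - regularity a b c d
  regularity-vieta =
    solve 4 (λ a b c d → E.jump a b c d ⊗ d ⊜ (E.regularity a b c (Κ 0ℤ) E.- E.regularity a b c d)) refl

  regularity-discriminant : ∀ a b c d →
    regularity a b c d ≡ (d - midpoint a b c) * (d - midpoint a b c) - + 4 * pairProduct a b c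
  regularity-discriminant = solve 4 (λ a b c d →
    E.regularity a b c d ⊜ ((d E.- E.midpoint a b c) ⊗ (d E.- E.midpoint a b c) E.- Κ (+ 4) ⊗ E.pairProduct a b c)) refl

  regularity-zero : ∀ a b c → regularity a b c 0ℤ ≡ (a + b - c) * (a + b - c) - + 4 * (a * b + 1ℤ)
  regularity-zero = solve 3 (λ a b c →
    E.regularity a b c (Κ 0ℤ) ⊜ ((a ⊕ b E.- c) ⊗ (a ⊕ b E.- c) E.- Κ (+ 4) ⊗ (a ⊗ b ⊕ Κ 1ℤ))) refl

  -- The margin is d² − (a + b − c)² + 4(ab + 1), with the difference of squares factored.
  regularity-zero-margin : ∀ a b c d →
    d * d ≡ regularity a b c 0ℤ + ((d - b + (c - a)) * (d - c + (a + b)) + + 4 * (a * b) + + 4)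
  regularity-zero-margin = solve 4 (λ a b c d →
    d ⊗ d ⊜
      (E.regularity a b c (Κ 0ℤ) ⊕ ((d E.- b ⊕ (c E.- a)) ⊗ (d E.- c ⊕ (a ⊕ b)) ⊕ Κ (+ 4) ⊗ (a ⊗ b) ⊕ Κ (+ 4)))) refl

  regularity-shift : ∀ a b c k →
    regularity a b c (midpoint a b c + + 2 * k) ≡ + 4 * (k * k) - + 4 * pairProduct a b c
  regularity-shift = solve 4 (λ a b c k →
    E.regularity a b c (E.midpoint a b c ⊕ Κ (+ 2) ⊗ k) ⊜ (Κ (+ 4) ⊗ (k ⊗ k) E.- Κ (+ 4) ⊗ E.pairProduct a b c)) refl

  -- For a, b, c ≥ 1 and e ≤ −1 written as 1 + x, 1 + y, 1 + z and −(1 + g), every summand is nonnegative.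
  regularity-negative-root : ∀ x y z g →
    regularity (1ℤ + x) (1ℤ + y) (1ℤ + z) (- (1ℤ + g)) ≡
      (x + y - z + 1ℤ) * (x + y - z + 1ℤ) + + 4 * ((1ℤ + x) * (1ℤ + y) * (z + g + z * g))
      + g * (g + + 8) + + 2 * ((1ℤ + g) * (x + y + z)) + + 3
  regularity-negative-root = solve 4 (λ x y z g →
    E.regularity (Κ 1ℤ ⊕ x) (Κ 1ℤ ⊕ y) (Κ 1ℤ ⊕ z) (⊝ (Κ 1ℤ ⊕ g)) ⊜
      ((x ⊕ y E.- z ⊕ Κ 1ℤ) ⊗ (x ⊕ y E.- z ⊕ Κ 1ℤ) ⊕ Κ (+ 4) ⊗ ((Κ 1ℤ ⊕ x) ⊗ (Κ 1ℤ ⊕ y) ⊗ (z ⊕ g ⊕ z ⊗ g))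
      ⊕ g ⊗ (g ⊕ Κ (+ 8)) ⊕ Κ (+ 2) ⊗ ((Κ 1ℤ ⊕ g) ⊗ (x ⊕ y ⊕ z)) ⊕ Κ (+ 3))) refl

  regular-swap₁₂ : ∀ {a b c d} → Regular a b c d → Regular b a c d
  regular-swap₁₂ {a} {b} {c} {d} (regular reg) = regular (trans (sym (regularity-swap₁₂ (+ a) (+ b) (+ c) (+ d))) reg)

  regular-swap₂₃ : ∀ {a b c d} → Regular a b c d → Regular a c b d
  regular-swap₂₃ {a} {b} {c} {d} (regular reg) = regular (trans (sym (regularity-swap₂₃ (+ a) (+ b) (+ c) (+ d))) reg)

  regular-swap₁₄ : ∀ {a b c d} → Regular a b c d → Regular d b c a
  regular-swap₁₄ {a} {b} {c} {d} (regular reg) = regular (trans (sym (regularity-swap₁₄ (+ a) (+ b) (+ c) (+ d))) reg)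

  regular-swap₂₄ : ∀ {a b c d} → Regular a b c d → Regular a d c b
  regular-swap₂₄ {a} {b} {c} {d} (regular reg) = regular (trans (sym (regularity-swap₂₄ (+ a) (+ b) (+ c) (+ d))) reg)

  regular-swap₃₄ : ∀ {a b c d} → Regular a b c d → Regular a b d c
  regular-swap₃₄ {a} {b} {c} {d} (regular reg) = regular (trans (sym (regularity-swap₃₄ (+ a) (+ b) (+ c) (+ d))) reg)

  0≤+ : ∀ n → 0ℤ ≤ + n
  0≤+ _ = +≤+ z≤n

  nonNeg-+ : ∀ {i j} → 0ℤ ≤ i → 0ℤ ≤ j → 0ℤ ≤ i + j
  nonNeg-+ = +-mono-≤

  nonNeg-* : ∀ {i j} → 0ℤ ≤ i → 0ℤ ≤ j → 0ℤ ≤ i * j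
  nonNeg-* {+ m} {+ n} _ _ = subst (0ℤ ≤_) (pos-* m n) (0≤+ (m ℕ.* n))

  nonNeg-square : ∀ i → 0ℤ ≤ i * i
  nonNeg-square (+ n) = nonNeg-* (0≤+ n) (0≤+ n)
  nonNeg-square -[1+ n ] = 0≤+ _

  regularity-root-nonNeg : ∀ {a b c} e → regularity (+ suc a) (+ suc b) (+ suc c) e ≡ 0ℤ → 0ℤ ≤ e
  regularity-root-nonNeg (+ n) _ = 0≤+ n
  regularity-root-nonNeg {a} {b} {c} -[1+ g ] root = contradiction (sym root) (<⇒≢ positive)
    where
    positive : 0ℤ < regularity (+ suc a) (+ suc b) (+ suc c) -[1+ g ]
    positive = subst (0ℤ <_) (sym (regularity-negative-root (+ a) (+ b) (+ c) (+ g)))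
      (+-mono-≤-< {0ℤ} {_} {0ℤ}
        (nonNeg-+ (nonNeg-+ (nonNeg-+ (nonNeg-square (+ a + + b - + c + 1ℤ))
          (nonNeg-* (0≤+ 4) (nonNeg-* (nonNeg-* (0≤+ (suc a)) (0≤+ (suc b)))
            (nonNeg-+ (0≤+ (c ℕ.+ g)) (nonNeg-* (0≤+ c) (0≤+ g))))))
          (nonNeg-* (0≤+ g) (0≤+ (g ℕ.+ 8))))
          (nonNeg-* (0≤+ 2) (nonNeg-* (0≤+ (suc g)) (0≤+ (a ℕ.+ b ℕ.+ c)))))
        (+<+ (ℕ.s≤s z≤n)))

  regularity-zero<square : ∀ {a b c d} → a ℕ.≤ c → b ℕ.≤ d → c ℕ.≤ d → regularity (+ a) (+ b) (+ c) 0ℤ < + d * + d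
  regularity-zero<square {a} {b} {c} {d} a≤c b≤d c≤d = begin-strict
    regularity (+ a) (+ b) (+ c) 0ℤ         ≡⟨ sym (+-identityʳ _) ⟩
    regularity (+ a) (+ b) (+ c) 0ℤ + 0ℤ    <⟨ +-monoʳ-< (regularity (+ a) (+ b) (+ c) 0ℤ) margin-positive ⟩
    regularity (+ a) (+ b) (+ c) 0ℤ + _     ≡⟨ sym (regularity-zero-margin (+ a) (+ b) (+ c) (+ d)) ⟩
    + d * + d                               ∎
    where
    open ≤-Reasoning
    margin-positive : 0ℤ < (+ d - + b + (+ c - + a)) * (+ d - + c + (+ a + + b)) + + 4 * (+ a * + b) + + 4
    margin-positive = +-mono-≤-< {0ℤ} {_} {0ℤ}
      (nonNeg-+ (nonNeg-* (nonNeg-+ (i≤j⇒0≤j-i (+≤+ b≤d)) (i≤j⇒0≤j-i (+≤+ a≤c)))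
                          (nonNeg-+ (i≤j⇒0≤j-i (+≤+ c≤d)) (0≤+ (a ℕ.+ b))))
                (nonNeg-* (0≤+ 4) (nonNeg-* (0≤+ a) (0≤+ b))))
      (+<+ (ℕ.s≤s z≤n))

  jump<max : ∀ {a b c d} → a ℕ.≤ d → b ℕ.≤ d → c ℕ.≤ d → Regular a b c d → jump (+ a) (+ b) (+ c) (+ d) < + d
  jump<max {a} {b} {c} {d} a≤d b≤d c≤d (regular reg) = *-cancelʳ-<-nonNeg (+ d) (begin-strict
    jump (+ a) (+ b) (+ c) (+ d) * + d                                 ≡⟨ regularity-vieta (+ a) (+ b) (+ c) (+ d) ⟩
    regularity (+ a) (+ b) (+ c) 0ℤ - regularity (+ a) (+ b) (+ c) (+ d) ≡⟨ cong (λ r → regularity (+ a) (+ b) (+ c) 0ℤ - r) reg ⟩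
    regularity (+ a) (+ b) (+ c) 0ℤ - 0ℤ                               ≡⟨ +-identityʳ _ ⟩
    regularity (+ a) (+ b) (+ c) 0ℤ                                    <⟨ constant<square ⟩
    + d * + d                                                          ∎)
    where
    open ≤-Reasoning
    constant<square : regularity (+ a) (+ b) (+ c) 0ℤ < + d * + d
    constant<square with ℕ.≤-total a c
    ... | inj₁ a≤c = regularity-zero<square a≤c b≤d c≤d
    ... | inj₂ c≤a =
      subst (_< + d * + d) (sym (regularity-swap₁₃ (+ a) (+ b) (+ c) 0ℤ)) (regularity-zero<square c≤a b≤d a≤d)

  regular-descent : ∀ {a b c d} → suc a ℕ.≤ d → suc b ℕ.≤ d → suc c ℕ.≤ d → Regular (suc a) (suc b) (suc c) d →
                    ∃ λ e → e ℕ.< d × Regular (suc a) (suc b) (suc c) e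
  regular-descent {a} {b} {c} {d} a<d b<d c<d (regular reg) =
    ∣ d′ ∣ , e<d , regular (trans (cong (regularity (+ suc a) (+ suc b) (+ suc c)) +∣d′∣≡d′) d′-root)
    where
    d′ : ℤ
    d′ = jump (+ suc a) (+ suc b) (+ suc c) (+ d)
    d′-root : regularity (+ suc a) (+ suc b) (+ suc c) d′ ≡ 0ℤ
    d′-root = trans (regularity-jump (+ suc a) (+ suc b) (+ suc c) (+ d)) reg
    +∣d′∣≡d′ : + ∣ d′ ∣ ≡ d′
    +∣d′∣≡d′ = 0≤i⇒+∣i∣≡i (regularity-root-nonNeg {a} {b} {c} d′ d′-root)
    e<d : ∣ d′ ∣ ℕ.< d
    e<d = drop‿+<+ (subst (_< + d) (sym +∣d′∣≡d′) (jump<max a<d b<d c<d (regular reg)))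

  i*i≡j*j⇒i≡±j : ∀ i j → i * i ≡ j * j → i ≡ j ⊎ i ≡ - j
  i*i≡j*j⇒i≡±j i j i²≡j² with i*j≡0⇒i≡0∨j≡0 (i - j) difference-of-squares
    where
    difference-of-squares : (i - j) * (i + j) ≡ 0ℤ
    difference-of-squares = trans (factor i j) (trans (cong (_- j * j) i²≡j²) (+-inverseʳ (j * j)))
      where
      factor : ∀ i j → (i - j) * (i + j) ≡ i * i - j * j
      factor = solve-∀
  ... | inj₁ i-j≡0 = inj₁ (i-j≡0⇒i≡j i j i-j≡0)
  ... | inj₂ i+j≡0 = inj₂ (i-j≡0⇒i≡j i (- j) (trans (cong (λ k → i + k) (neg-involutive j)) i+j≡0))

  root-up-to-sign : ∀ x r s t → x * x ≡ (+ 2 * r * s * t) * (+ 2 * r * s * t) →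
                    ∃ λ u → u * u ≡ r * r × x ≡ + 2 * u * s * t
  root-up-to-sign x r s t x²≡[2rst]² with i*i≡j*j⇒i≡±j x (+ 2 * r * s * t) x²≡[2rst]²
  ... | inj₁ x≡2rst = r , refl , x≡2rst
  ... | inj₂ x≡-2rst = - r , negate-square r , trans x≡-2rst (negate-root r s t)
    where
    negate-square : ∀ r → - r * - r ≡ r * r
    negate-square = solve-∀
    negate-root : ∀ r s t → - (+ 2 * r * s * t) ≡ + 2 * (- r) * s * t
    negate-root = solve-∀

  regularity-root² : ∀ a b c d r s t → regularity a b c d ≡ 0ℤ →
                      a * b + 1ℤ ≡ r * r → a * c + 1ℤ ≡ s * s → b * c + 1ℤ ≡ t * t →
                      (d - midpoint a b c) * (d - midpoint a b c) ≡ (+ 2 * r * s * t) * (+ 2 * r * s * t)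
  regularity-root² a b c d r s t root ab ac bc = begin
    (d - midpoint a b c) * (d - midpoint a b c)
      ≡⟨ i-j≡0⇒i≡j _ _ (trans (sym (regularity-discriminant a b c d)) root) ⟩
    + 4 * pairProduct a b c
      ≡⟨ cong (λ p → + 4 * p) (cong₂ _*_ (cong₂ _*_ ab ac) bc) ⟩
    + 4 * (r * r * (s * s) * (t * t))
      ≡⟨ regroup r s t ⟩
    (+ 2 * r * s * t) * (+ 2 * r * s * t) ∎
    where
    open ≡-Reasoning
    regroup : ∀ r s t → + 4 * (r * r * (s * s) * (t * t)) ≡ (+ 2 * r * s * t) * (+ 2 * r * s * t)
    regroup = solve-∀

  square-extension : ∀ a b c d u s t → a * b + 1ℤ ≡ u * u → a * c + 1ℤ ≡ s * s → b * c + 1ℤ ≡ t * t →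
                     d - midpoint a b c ≡ + 2 * u * s * t → a * d + 1ℤ ≡ (a * t + u * s) * (a * t + u * s)
  square-extension a b c d u s t ab ac bc root = begin
    a * d + 1ℤ
      ≡⟨ expand a b c d ⟩
    a * a * (b * c + 1ℤ) + a * (d - midpoint a b c) + (a * b + 1ℤ) * (a * c + 1ℤ)
      ≡⟨ cong₂ (λ x y → a * a * x + a * y + (a * b + 1ℤ) * (a * c + 1ℤ)) bc root ⟩
    a * a * (t * t) + a * (+ 2 * u * s * t) + (a * b + 1ℤ) * (a * c + 1ℤ)
      ≡⟨ cong (λ p → a * a * (t * t) + a * (+ 2 * u * s * t) + p) (cong₂ _*_ ab ac) ⟩
    a * a * (t * t) + a * (+ 2 * u * s * t) + u * u * (s * s)
      ≡⟨ complete-square a u s t ⟩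
    (a * t + u * s) * (a * t + u * s) ∎
    where
    open ≡-Reasoning
    expand : ∀ a b c d → a * d + 1ℤ ≡ a * a * (b * c + 1ℤ) + a * (d - midpoint a b c) + (a * b + 1ℤ) * (a * c + 1ℤ)
    expand = solve 4 (λ a b c d →
      (a ⊗ d ⊕ Κ 1ℤ) ⊜
        (a ⊗ a ⊗ (b ⊗ c ⊕ Κ 1ℤ) ⊕ a ⊗ (d E.- E.midpoint a b c) ⊕ (a ⊗ b ⊕ Κ 1ℤ) ⊗ (a ⊗ c ⊕ Κ 1ℤ))) refl
    complete-square : ∀ a u s t → a * a * (t * t) + a * (+ 2 * u * s * t) + u * u * (s * s) ≡ (a * t + u * s) * (a * t + u * s)
    complete-square = solve-∀

  pos-*-+1 : ∀ m n → + (m ℕ.* n ℕ.+ 1) ≡ + m * + n + 1ℤ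
  pos-*-+1 m n = trans (pos-+ (m ℕ.* n) 1) (cong (_+ 1ℤ) (pos-* m n))

  isSquare⇒pos : ∀ m n → IsSquare (m ℕ.* n ℕ.+ 1) → ∃ λ k → + m * + n + 1ℤ ≡ + k * + k
  isSquare⇒pos m n (k , eq) = k , trans (sym (pos-*-+1 m n)) (trans (cong +_ eq) (pos-* k k))

  pos⇒isSquare : ∀ m n x → + m * + n + 1ℤ ≡ x * x → IsSquare (m ℕ.* n ℕ.+ 1)
  pos⇒isSquare m n x eq = ∣ x ∣ , trans (cong ∣_∣ (trans (pos-*-+1 m n) eq)) (abs-* x x)

  regular-extend : ∀ {a b c d} → Regular a b c d →
                   IsSquare (a ℕ.* b ℕ.+ 1) → IsSquare (a ℕ.* c ℕ.+ 1) → IsSquare (b ℕ.* c ℕ.+ 1) →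
                   IsSquare (a ℕ.* d ℕ.+ 1)
  regular-extend {a} {b} {c} {d} (regular reg) sab sac sbc =
    let r , ab = isSquare⇒pos a b sab
        s , ac = isSquare⇒pos a c sac
        t , bc = isSquare⇒pos b c sbc
        u , u²≡r² , root = root-up-to-sign (+ d - midpoint (+ a) (+ b) (+ c)) (+ r) (+ s) (+ t)
                             (regularity-root² (+ a) (+ b) (+ c) (+ d) (+ r) (+ s) (+ t) reg ab ac bc)
    in pos⇒isSquare a d (+ a * + t + u * + s)
         (square-extension (+ a) (+ b) (+ c) (+ d) u (+ s) (+ t) (trans ab (sym u²≡r²)) ac bc root)

  regular-zero⇒isSquare : ∀ {a b c} → Regular a b c 0 → IsSquare (a ℕ.* b ℕ.+ 1)
  regular-zero⇒isSquare {a} {b} {c} (regular reg) = square≡4*⇒isSquare ∣ x ∣ (begin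
    ∣ x ∣ ℕ.* ∣ x ∣                    ≡⟨ sym (abs-* x x) ⟩
    ∣ x * x ∣                          ≡⟨ cong ∣_∣ (i-j≡0⇒i≡j (x * x) (+ 4 * (+ a * + b + 1ℤ)) x²-4[ab+1]≡0) ⟩
    ∣ + 4 * (+ a * + b + 1ℤ) ∣         ≡⟨ cong (λ i → ∣ + 4 * i ∣) (sym (pos-*-+1 a b)) ⟩
    ∣ + 4 * + (a ℕ.* b ℕ.+ 1) ∣        ≡⟨ abs-* (+ 4) (+ (a ℕ.* b ℕ.+ 1)) ⟩
    4 ℕ.* (a ℕ.* b ℕ.+ 1)              ∎)
    where
    open ≡-Reasoning
    x : ℤ
    x = + a + + b - + c
    x²-4[ab+1]≡0 : x * x - + 4 * (+ a * + b + 1ℤ) ≡ 0ℤ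
    x²-4[ab+1]≡0 = trans (sym (regularity-zero (+ a) (+ b) (+ c))) reg

  pos-pairProduct : ∀ a b c →
    + ((a ℕ.* b ℕ.+ 1) ℕ.* (a ℕ.* c ℕ.+ 1) ℕ.* (b ℕ.* c ℕ.+ 1)) ≡ pairProduct (+ a) (+ b) (+ c)
  pos-pairProduct a b c = begin
    + ((a ℕ.* b ℕ.+ 1) ℕ.* (a ℕ.* c ℕ.+ 1) ℕ.* (b ℕ.* c ℕ.+ 1))
      ≡⟨ pos-* ((a ℕ.* b ℕ.+ 1) ℕ.* (a ℕ.* c ℕ.+ 1)) (b ℕ.* c ℕ.+ 1) ⟩
    + ((a ℕ.* b ℕ.+ 1) ℕ.* (a ℕ.* c ℕ.+ 1)) * + (b ℕ.* c ℕ.+ 1)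
      ≡⟨ cong (_* + (b ℕ.* c ℕ.+ 1)) (pos-* (a ℕ.* b ℕ.+ 1) (a ℕ.* c ℕ.+ 1)) ⟩
    + (a ℕ.* b ℕ.+ 1) * + (a ℕ.* c ℕ.+ 1) * + (b ℕ.* c ℕ.+ 1)
      ≡⟨ cong₂ _*_ (cong₂ _*_ (pos-*-+1 a b) (pos-*-+1 a c)) (pos-*-+1 b c) ⟩
    pairProduct (+ a) (+ b) (+ c) ∎
    where open ≡-Reasoning

  isSquare-product⇒regular : ∀ a b c → IsSquare ((a ℕ.* b ℕ.+ 1) ℕ.* (a ℕ.* c ℕ.+ 1) ℕ.* (b ℕ.* c ℕ.+ 1)) →
                             ∃ λ d → Regular a b c d
  isSquare-product⇒regular a b c (k , P≡k²) =
    ∣ d ∣ , regular (trans (cong (regularity (+ a) (+ b) (+ c)) (0≤i⇒+∣i∣≡i d≥0)) d-root)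
    where
    open ≡-Reasoning
    P : ℤ
    P = pairProduct (+ a) (+ b) (+ c)
    P≡K² : P ≡ + k * + k
    P≡K² = trans (sym (pos-pairProduct a b c)) (trans (cong +_ P≡k²) (pos-* k k))
    d : ℤ
    d = midpoint (+ a) (+ b) (+ c) + + 2 * + k
    d≥0 : 0ℤ ≤ d
    d≥0 = nonNeg-+ (nonNeg-+ (0≤+ (a ℕ.+ b ℕ.+ c)) (nonNeg-* (nonNeg-* (nonNeg-* (0≤+ 2) (0≤+ a)) (0≤+ b)) (0≤+ c)))
                   (nonNeg-* (0≤+ 2) (0≤+ k))
    d-root : regularity (+ a) (+ b) (+ c) d ≡ 0ℤ
    d-root = begin
      regularity (+ a) (+ b) (+ c) d     ≡⟨ regularity-shift (+ a) (+ b) (+ c) (+ k) ⟩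
      + 4 * (+ k * + k) - + 4 * P        ≡⟨ cong (λ q → + 4 * q - + 4 * P) P≡K² ⟨
      + 4 * P - + 4 * P                  ≡⟨ +-inverseʳ (+ 4 * P) ⟩
      0ℤ                                 ∎

open Regularity
  using ( Regular; regular-swap₁₂; regular-swap₂₃; regular-swap₁₄; regular-swap₂₄; regular-swap₃₄
        ; regular-zero⇒isSquare; regular-extend; regular-descent; isSquare-product⇒regular )
open import Data.Nat using (_*_; _+_; _≤_; _<_; NonZero)
open import Data.Nat.Induction using (<-rec)
open import Data.Nat.Properties using (*-comm; *-zeroʳ; ≤-total; ≤-trans; +-monoʳ-<)

isSquare-*-comm : ∀ m n → IsSquare (m * n + 1) → IsSquare (n * m + 1)
isSquare-*-comm m n = subst IsSquare (cong (_+ 1) (*-comm m n))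

record DiophantineQuadruple (a b c d : ℕ) : Set where
  constructor diophantine
  field
    ab : IsSquare (a * b + 1)
    ac : IsSquare (a * c + 1)
    ad : IsSquare (a * d + 1)
    bc : IsSquare (b * c + 1)
    bd : IsSquare (b * d + 1)
    cd : IsSquare (c * d + 1)

diophantine-swap₁₄ : ∀ {a b c d} → DiophantineQuadruple d b c a → DiophantineQuadruple a b c d
diophantine-swap₁₄ {a} {b} {c} {d} (diophantine db dc da bc ba ca) =
  diophantine (isSquare-*-comm b a ba) (isSquare-*-comm c a ca) (isSquare-*-comm d a da) bc
              (isSquare-*-comm d b db) (isSquare-*-comm d c dc)

diophantine-swap₂₄ : ∀ {a b c d} → DiophantineQuadruple a d c b → DiophantineQuadruple a b c d
diophantine-swap₂₄ {a} {b} {c} {d} (diophantine ad ac ab dc db cb) =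
  diophantine ab ac ad (isSquare-*-comm c b cb) (isSquare-*-comm d b db) (isSquare-*-comm d c dc)

diophantine-swap₃₄ : ∀ {a b c d} → DiophantineQuadruple a b d c → DiophantineQuadruple a b c d
diophantine-swap₃₄ {a} {b} {c} {d} (diophantine ab ad ac bd bc dc) = diophantine ab ac ad bc bd (isSquare-*-comm d c dc)

isSquare-*0+1 : ∀ a → IsSquare (a * 0 + 1)
isSquare-*0+1 a = 1 , cong (_+ 1) (*-zeroʳ a)

regular-zero⇒diophantine : ∀ {a b c} → Regular a b c 0 → DiophantineQuadruple a b c 0
regular-zero⇒diophantine {a} {b} {c} reg =
  diophantine (regular-zero⇒isSquare reg) (regular-zero⇒isSquare (regular-swap₂₃ reg)) (isSquare-*0+1 a)
              (regular-zero⇒isSquare (regular-swap₂₃ (regular-swap₁₂ reg))) (isSquare-*0+1 b) (isSquare-*0+1 c)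

regular-triple⇒diophantine : ∀ {a b c d} → Regular a b c d →
                             IsSquare (a * b + 1) → IsSquare (a * c + 1) → IsSquare (b * c + 1) → DiophantineQuadruple a b c d
regular-triple⇒diophantine {a} {b} {c} reg ab ac bc =
  diophantine ab ac (regular-extend reg ab ac bc) bc
              (regular-extend (regular-swap₁₂ reg) (isSquare-*-comm a b ab) bc ac)
              (regular-extend (regular-swap₁₂ (regular-swap₂₃ reg)) (isSquare-*-comm a c ac) (isSquare-*-comm b c bc) ab)

wlog-max : (P : ℕ → ℕ → ℕ → ℕ → Set) →
           (∀ {a b c d} → P d b c a → P a b c d) →
           (∀ {a b c d} → P a d c b → P a b c d) →
           (∀ {a b c d} → P a b d c → P a b c d) →
           (∀ {a b c d} → a ≤ d → b ≤ d → c ≤ d → P a b c d) →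
           ∀ a b c d → P a b c d
wlog-max P swap₁₄ swap₂₄ swap₃₄ max a b c d = [ max₂ , (λ d≤a → swap₁₄ (max₂ d≤a)) ]′ (≤-total a d)
  where
  max₃ : ∀ {a b c d} → a ≤ d → b ≤ d → P a b c d
  max₃ {c = c} {d} a≤d b≤d with ≤-total c d
  ... | inj₁ c≤d = max a≤d b≤d c≤d
  ... | inj₂ d≤c = swap₃₄ (max (≤-trans a≤d d≤c) (≤-trans b≤d d≤c) d≤c)
  max₂ : ∀ {a b c d} → a ≤ d → P a b c d
  max₂ {b = b} {d = d} a≤d with ≤-total b d
  ... | inj₁ b≤d = max₃ a≤d b≤d
  ... | inj₂ d≤b = swap₂₄ (max₃ (≤-trans a≤d d≤b) d≤b)

regular⇒diophantine : ∀ a b c d → Regular a b c d → DiophantineQuadruple a b c d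
regular⇒diophantine a b c d = <-rec (λ n → ∀ a b c d → Claim n a b c d) step (a + b + c + d) a b c d refl
  where
  Claim : ℕ → ℕ → ℕ → ℕ → ℕ → Set
  Claim n a b c d = a + b + c + d ≡ n → Regular a b c d → DiophantineQuadruple a b c d

  max-case : ∀ {n} → (∀ {m} → m < n → ∀ a b c d → Claim m a b c d) →
             ∀ {a b c d} → a ≤ d → b ≤ d → c ≤ d → Claim n a b c d
  max-case _ {zero} _ _ _ _ reg = diophantine-swap₁₄ (regular-zero⇒diophantine (regular-swap₁₄ reg))
  max-case _ {suc _} {zero} _ _ _ _ reg = diophantine-swap₂₄ (regular-zero⇒diophantine (regular-swap₂₄ reg))
  max-case _ {suc _} {suc _} {zero} _ _ _ _ reg = diophantine-swap₃₄ (regular-zero⇒diophantine (regular-swap₃₄ reg))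
  max-case ih {suc a} {suc b} {suc c} a≤d b≤d c≤d refl reg =
    let e , e<d , reg′ = regular-descent a≤d b≤d c≤d reg
        diophantine ab ac _ bc _ _ = ih (+-monoʳ-< (suc a + suc b + suc c) e<d) _ _ _ _ refl reg′
    in regular-triple⇒diophantine reg ab ac bc

  permute : ∀ {n a b c d a′ b′ c′ d′} →
            (Regular a b c d → Regular a′ b′ c′ d′) →
            (DiophantineQuadruple a′ b′ c′ d′ → DiophantineQuadruple a b c d) →
            a′ + b′ + c′ + d′ ≡ a + b + c + d → Claim n a′ b′ c′ d′ → Claim n a b c d
  permute regular-perm diophantine-perm sum-perm claim sum reg =
    diophantine-perm (claim (trans sum-perm sum) (regular-perm reg))

  step : ∀ n → (∀ {m} → m < n → ∀ a b c d → Claim m a b c d) → ∀ a b c d → Claim n a b c d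
  step n ih = wlog-max (Claim n)
    (λ {a} {b} {c} {d} → permute regular-swap₁₄ diophantine-swap₁₄ (ℕ-Solver.solve (a ∷ b ∷ c ∷ d ∷ [])))
    (λ {a} {b} {c} {d} → permute regular-swap₂₄ diophantine-swap₂₄ (ℕ-Solver.solve (a ∷ b ∷ c ∷ d ∷ [])))
    (λ {a} {b} {c} {d} → permute regular-swap₃₄ diophantine-swap₃₄ (ℕ-Solver.solve (a ∷ b ∷ c ∷ d ∷ [])))
    (max-case ih)

mainTheorem2 : (a b c : ℕ) → .{{NonZero a}} → .{{NonZero b}} → .{{NonZero c}} →
    IsSquare ((a * b + 1) * (a * c + 1) * (b * c + 1)) →
    IsSquare (a * b + 1) × IsSquare (a * c + 1) × IsSquare (b * c + 1)
mainTheorem2 a b c square =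
  let d , reg = isSquare-product⇒regular a b c square
      diophantine ab ac _ bc _ _ = regular⇒diophantine a b c d reg
  in ab , ac , bc
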